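{- Let $\mathbb F$ be a field, $n\ge 2$, and let $H\in\mathrm{Mat}(3,2n-1,\mathbb F)$ be a parity-check matrix of a linear code $\mathcal D\subseteq\mathbb F^{2n-1}$ of dimension $2n-4$ and minimum Hamming distance at least $2$. For $i\in\{1,\dots,n\}$ let $P_i\in\mathrm{PG}(2,\mathbb F)$ be the projective point spanned by the $(2i-1)$-th column of $H$, and for $i\in\{1,\dots,n-1\}$ let $Q_i$ be the point spanned by the $(2i)$-th column of $H$. Then $\mathcal D$ is $\mathcal N$-avoiding if and only if (1) $P_i\neq P_j$ for all distinct $i,j\in\{1,\dots,n\}$, and (2) $Q_i\notin\langle P_i,P_{i+1}\rangle$ (the line through $P_i$ and $P_{i+1}$) for every $i\in\{1,\dots,n-1\}$.
   Context: A parity-check matrix of $\mathcal D$ is a matrix whose rows form a basis of the dual code $\mathcal D^\perp$ (with respect to the standard dot product), so $\mathcal D=\{x\in\mathbb F^{2n-1}: Hx^{T}=0\}$ and $H$ has rank $3$; minimum distance at least $2$ guarantees all columns of $H$ are nonzero. $\mathrm{PG}(2,\mathbb F)$ is the projective plane of $\mathbb F^3$. $\mathcal N$ is the collection of subsets of $\{1,\dots,2n-1\}$ consisting of $X_{i,j}=\{2i-1,2j-1\}$ for $1\le i<j\le n$, $Y_i=\{2i\}$ for $1\le i\le n-1$, and $Z_i=\{2i-1,2i,2i+1\}$ for $1\le i\le n-1$. A code $\mathcal D\subseteq\mathbb F^{2n-1}$ of dimension $2n-4$ is $\mathcal N$-avoiding if no nonzero $c\in\mathcal D$ has $\{i:c_i\ne0\}\subseteq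 I$ for some $I\in\mathcal N$. -}

module Defs where

open import Level using (Level; _⊔_) renaming (suc to lsuc)
open import Algebra.Bundles using (CommutativeRing)
import Data.Nat as ℕ
open ℕ using (ℕ; suc; _∸_; _≤_; _<_)
import Data.Fin as Fin
open Fin using (Fin; toℕ)
open import Data.Product using (Σ; ∃; _×_)
open import Data.Sum using (_⊎_)
open import Relation.Nullary using (¬_)
open import Relation.Binary.PropositionalEquality using (_≡_)

record Field (c ℓ : Level) : Set (lsuc (c ⊔ ℓ)) where
  field
    commutativeRing : CommutativeRing c ℓ
  open CommutativeRing commutativeRing public
  field
    0≉1     : ¬ (0# ≈ 1#)
    inverse : ∀ x → ¬ (x ≈ 0#) → Σ Carrier (λ y → x * y ≈ 1#)

module FieldDefs {c ℓ : Level} (F : Field c ℓ) where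
  open Field F

  Vec : ℕ → Set c
  Vec m = Fin m → Carrier

  Mat3 : ℕ → Set c
  Mat3 m = Fin 3 → Fin m → Carrier

  column : ∀ {m} → Mat3 m → Fin m → Vec 3
  column H k r = H r k

  IsZeroVec : ∀ {m} → Vec m → Set ℓ
  IsZeroVec v = ∀ k → v k ≈ 0#

  ∑ : ∀ m → (Fin m → Carrier) → Carrier
  ∑ ℕ.zero    f = 0#
  ∑ (suc m)   f = f Fin.zero + ∑ m (λ k → f (Fin.suc k))

  mulVec : ∀ {m} → Mat3 m → Vec m → Vec 3
  mulVec {m} H x r = ∑ m (λ k → H r k * x k)

  InCode : ∀ {m} → Mat3 m → Vec m → Set ℓ
  InCode H x = IsZeroVec (mulVec H x)

  -- H has rank 3 (rows linearly independent), so that the rows form a basis of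
  -- D^⊥ and D has dimension m - 3
  RowsIndependent : ∀ {m} → Mat3 m → Set (c ⊔ ℓ)
  RowsIndependent {m} H =
    (a : Vec 3) → (∀ k → ∑ 3 (λ r → a r * H r k) ≈ 0#) → IsZeroVec a

  -- support of x is contained in a subset I of {1,…,m} (1-based indices,
  -- I given as a predicate on ℕ)
  SupportIn : ∀ {m} → Vec m → (ℕ → Set) → Set ℓ
  SupportIn x I = ∀ k → ¬ I (suc (toℕ k)) → x k ≈ 0#

  -- minimum Hamming distance ≥ 2: no nonzero codeword of weight ≤ 1
  MinDistAtLeast2 : ∀ {m} → Mat3 m → Set (c ⊔ ℓ)
  MinDistAtLeast2 {m} H =
    (x : Vec m) → InCode H x → ¬ IsZeroVec x →
    (j : ℕ) → ¬ SupportIn x (λ k → k ≡ j)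

  InSpan1 : Vec 3 → Vec 3 → Set (c ⊔ ℓ)
  InSpan1 v w = Σ Carrier (λ λ₀ → ∀ r → v r ≈ λ₀ * w r)

  InSpan2 : Vec 3 → Vec 3 → Vec 3 → Set (c ⊔ ℓ)
  InSpan2 v w₁ w₂ =
    Σ Carrier (λ a → Σ Carrier (λ b → ∀ r → v r ≈ a * w₁ r + b * w₂ r))

  -- equality of projective points ⟨v⟩ = ⟨w⟩ (as subspaces)
  SamePoint : Vec 3 → Vec 3 → Set (c ⊔ ℓ)
  SamePoint v w = InSpan1 v w × InSpan1 w v

-- The family 𝒩 of subsets of {1,…,2n-1} (1-based indices)
data NSet (n : ℕ) : Set where
  X : (i j : ℕ) → 1 ≤ i → i < j → j ≤ n → NSet n
  Y : (i : ℕ) → 1 ≤ i → i ≤ n ∸ 1 → NSet n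
  Z : (i : ℕ) → 1 ≤ i → i ≤ n ∸ 1 → NSet n

_∈N_ : ∀ {n} → ℕ → NSet n → Set
k ∈N X i j _ _ _ = (k ≡ 2 ℕ.* i ∸ 1) ⊎ (k ≡ 2 ℕ.* j ∸ 1)
k ∈N Y i _ _     = k ≡ 2 ℕ.* i
k ∈N Z i _ _     = (k ≡ 2 ℕ.* i ∸ 1) ⊎ ((k ≡ 2 ℕ.* i) ⊎ (k ≡ 2 ℕ.* i ℕ.+ 1))

module FieldDefs2 {c ℓ : Level} (F : Field c ℓ) where
  open Field F
  open FieldDefs F

  NAvoiding : (n : ℕ) → Mat3 (2 ℕ.* n ∸ 1) → Set (c ⊔ ℓ)
  NAvoiding n H =
    (x : Vec (2 ℕ.* n ∸ 1)) → InCode H x → ¬ IsZeroVec x →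
    (I : NSet n) → ¬ SupportIn x (λ k → k ∈N I)

  -- condition (1): P_i ≠ P_j for distinct i, j ∈ {1,…,n};
  -- P_i is spanned by column 2i-1 (1-based), i.e. Fin index 2i-2.
  Cond1 : (n : ℕ) → Mat3 (2 ℕ.* n ∸ 1) → Set (c ⊔ ℓ)
  Cond1 n H =
    (i j : ℕ) → 1 ≤ i → i ≤ n → 1 ≤ j → j ≤ n → ¬ (i ≡ j) →
    (a b : Fin (2 ℕ.* n ∸ 1)) → suc (toℕ a) ≡ 2 ℕ.* i ∸ 1 → suc (toℕ b) ≡ 2 ℕ.* j ∸ 1 →
    ¬ SamePoint (column H a) (column H b)

  -- condition (2): Q_i ∉ ⟨P_i, P_{i+1}⟩ for i ∈ {1,…,n-1};
  -- Q_i is spanned by column 2i (1-based).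
  Cond2 : (n : ℕ) → Mat3 (2 ℕ.* n ∸ 1) → Set (c ⊔ ℓ)
  Cond2 n H =
    (i : ℕ) → 1 ≤ i → i ≤ n ∸ 1 →
    (a q b : Fin (2 ℕ.* n ∸ 1)) →
    suc (toℕ a) ≡ 2 ℕ.* i ∸ 1 → suc (toℕ q) ≡ 2 ℕ.* i → suc (toℕ b) ≡ 2 ℕ.* i ℕ.+ 1 →
    ¬ InSpan2 (column H q) (column H a) (column H b)

-- A nonzero codeword supported on a set of coordinates is a linear dependency among the
-- corresponding columns of H, and minimum distance ≥ 2 rules out a dependency on a single
-- column. Hence no codeword lives on Y_i; a codeword on X_{i,j} exists iff the columns spanning
-- P_i and P_j are proportional; and a codeword on Z_i either has a nonzero entry at 2i, which
-- writes Q_i as a combination of P_i and P_{i+1}, or is already a codeword on X_{i,i+1}.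
module Submission where

open import Defs
open import Level using (Level; 0ℓ; _⊔_)
open import Data.Nat using (ℕ; _*_; _∸_; _≤_)
open import Data.Product using (_×_)
open import Function.Bundles using (_⇔_)

open import Data.Nat as ℕ using (suc; _<_; z≤n; s≤s; s<s⁻¹)
import Data.Nat.Properties as ℕₚ
open import Data.Fin using (Fin; zero; suc; toℕ; fromℕ<; _≟_)
import Data.Fin.Properties as Finₚ
open import Data.Vec.Functional using (updateAt)
open import Data.Vec.Functional.Properties using (updateAt-updates; updateAt-minimal)
open import Data.Product using (Σ; _,_; proj₁; proj₂)
open import Data.Sum using (inj₁; inj₂; [_,_]′; swap) renaming (map to ⊎-map)
open import Function using (_∘_; id; const)
open import Function.Bundles using (mk⇔)
open import Relation.Nullary using (¬_; yes; no)
open import Relation.Nullary.Decidable using (¬¬-excluded-middle)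
open import Relation.Unary using (Pred; ∅; ｛_｝; _∪_; _∈_; _∉_; _⊆_; _≐_)
open import Relation.Binary.Definitions using (tri<; tri≈; tri>)
open import Relation.Binary.PropositionalEquality as ≡ using (_≡_; _≢_; refl; cong)
import Algebra.Properties.CommutativeSemigroup as CommutativeSemigroupProperties

2*suc∸1 : ∀ i → 2 * suc i ∸ 1 ≡ suc (2 * i)
2*suc∸1 i = cong (_∸ 1) (ℕₚ.*-suc 2 i)

1≤2*i∸1 : ∀ {i} → 1 ≤ i → 1 ≤ 2 * i ∸ 1
1≤2*i∸1 {suc i} _ rewrite 2*suc∸1 i = s≤s z≤n

2*i∸1-mono-≤ : ∀ {i j} → i ≤ j → 2 * i ∸ 1 ≤ 2 * j ∸ 1
2*i∸1-mono-≤ i≤j = ℕₚ.∸-monoˡ-≤ 1 (ℕₚ.*-monoʳ-≤ 2 i≤j)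

2*i∸1-mono-< : ∀ {i j} → 1 ≤ i → i < j → 2 * i ∸ 1 < 2 * j ∸ 1
2*i∸1-mono-< {i} 1≤i i<j = ℕₚ.∸-monoˡ-< (ℕₚ.*-monoʳ-< 2 i<j) (ℕₚ.≤-trans 1≤i (ℕₚ.m≤n*m i 2))

2*i∸1<2*i : ∀ {i} → 1 ≤ i → 2 * i ∸ 1 < 2 * i
2*i∸1<2*i {suc i} _ = ℕₚ.n<1+n _

2*i<2*n∸1 : ∀ {i n} → i < n → 2 * i < 2 * n ∸ 1
2*i<2*n∸1 {i} {n} i<n = ≡.subst (_≤ 2 * n ∸ 1) (2*suc∸1 i) (2*i∸1-mono-≤ i<n)

≤∸1⇒< : ∀ {i n} → 1 ≤ i → i ≤ n ∸ 1 → i < n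
≤∸1⇒< {n = suc n} _ i≤n = s≤s i≤n
≤∸1⇒< {suc _} {ℕ.zero} _ ()

position : ∀ {m s : ℕ} → 1 ≤ s → s ≤ m → Σ (Fin m) (λ k → suc (toℕ k) ≡ s)
position {s = suc s} _ s<m = fromℕ< s<m , cong suc (Finₚ.toℕ-fromℕ< s<m)

position-≐ : ∀ {m} {s : ℕ} {a : Fin m} → suc (toℕ a) ≡ s → (λ k → suc (toℕ k) ≡ s) ≐ ｛ a ｝
position-≐ refl = (λ e → Finₚ.toℕ-injective (ℕₚ.suc-injective (≡.sym e))) , λ { refl → refl }

positions-≢ : ∀ {m} {s t : ℕ} {a b : Fin m} → suc (toℕ a) ≡ s → suc (toℕ b) ≡ t → s < t → a ≢ b
positions-≢ refl refl s<t = Finₚ.<⇒≢ (s<s⁻¹ s<t)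

∪-cong-≐ : ∀ {a p} {A : Set a} {P P′ Q Q′ : Pred A p} → P ≐ P′ → Q ≐ Q′ → P ∪ Q ≐ P′ ∪ Q′
∪-cong-≐ (P⊆ , ⊇P) (Q⊆ , ⊇Q) = ⊎-map P⊆ Q⊆ , ⊎-map ⊇P ⊇Q

module LinearAlgebra {c ℓ : Level} (F : Field c ℓ) where
  open Field F hiding (zero) renaming (_*_ to _·_; refl to ≈-refl; sym to ≈-sym; trans to ≈-trans)
  open FieldDefs F
  open CommutativeSemigroupProperties +-commutativeSemigroup using (x∙yz≈y∙xz)
  open CommutativeSemigroupProperties *-commutativeSemigroup using () renaming (xy∙z≈yz∙x to xy·z≈yz·x)
  open import Algebra.Properties.Group +-group using (inverseˡ-unique)
  open import Algebra.Properties.AbelianGroup +-abelianGroup using (⁻¹-∙-comm)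
  open import Algebra.Properties.Ring ring using (-‿distribˡ-*; -‿distribʳ-*)
  open import Relation.Binary.Reasoning.Setoid setoid

  Supported : ∀ {m} → Vec m → Pred (Fin m) 0ℓ → Set ℓ
  Supported x S = ∀ k → k ∉ S → x k ≈ 0#

  Supported-mono : ∀ {m} {x : Vec m} {S T} → Supported x S → S ⊆ T → Supported x T
  Supported-mono x∈S S⊆T k k∉T = x∈S k (k∉T ∘ S⊆T)

  Supported-shrink : ∀ {m} {x : Vec m} {a S} → x a ≈ 0# → Supported x (｛ a ｝ ∪ S) → Supported x S
  Supported-shrink {a = a} xa≈0 x∈ k k∉S with a ≟ k
  ... | yes refl = xa≈0
  ... | no a≢k = x∈ k [ a≢k , k∉S ]′

  Supported-*ˡ : ∀ {m} {x : Vec m} {S} (h : Vec m) → Supported x S → Supported (λ k → h k · x k) S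
  Supported-*ˡ h x∈ k k∉ = ≈-trans (*-congˡ (x∈ k k∉)) (zeroʳ (h k))

  infixl 5 _[_]≔_
  _[_]≔_ : ∀ {m} → Vec m → Fin m → Carrier → Vec m
  x [ a ]≔ α = updateAt x a (const α)

  []≔-supported : ∀ {m} {x : Vec m} {S a α} → a ∈ S → Supported x S → Supported (x [ a ]≔ α) S
  []≔-supported {x = x} {a = a} a∈S x∈S k k∉S =
    ≈-trans (reflexive (updateAt-minimal k a x λ { refl → k∉S a∈S })) (x∈S k k∉S)

  []≔0-supported : ∀ {m} {x : Vec m} {a S} → Supported x (｛ a ｝ ∪ S) → Supported (x [ a ]≔ 0#) S
  []≔0-supported {x = x} {a} x∈ k k∉S with a ≟ k
  ... | yes refl = reflexive (updateAt-updates a x)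
  ... | no a≢k = ≈-trans (reflexive (updateAt-minimal k a x (a≢k ∘ ≡.sym))) (x∈ k [ a≢k , k∉S ]′)

  ∑-zero : ∀ m {f : Vec m} → IsZeroVec f → ∑ m f ≈ 0#
  ∑-zero ℕ.zero    _   = ≈-refl
  ∑-zero (suc m) f≈0 = ≈-trans (+-cong (f≈0 zero) (∑-zero m (f≈0 ∘ suc))) (+-identityˡ 0#)

  ∑-extract : ∀ m (f : Vec m) a → ∑ m f ≈ f a + ∑ m (f [ a ]≔ 0#)
  ∑-extract (suc m) f zero    = +-congˡ (≈-sym (+-identityˡ _))
  ∑-extract (suc m) f (suc a) = ≈-trans (+-congˡ (∑-extract m (f ∘ suc) a)) (x∙yz≈y∙xz _ _ _)

  ∑-single : ∀ m {f : Vec m} {a} → Supported f ｛ a ｝ → ∑ m f ≈ f a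
  ∑-single m {f} {a} f∈ = begin
    ∑ m f                   ≈⟨ ∑-extract m f a ⟩
    f a + ∑ m (f [ a ]≔ 0#) ≈⟨ +-congˡ (∑-zero m λ k → []≔0-supported {S = ∅} (Supported-mono f∈ inj₁) k λ ()) ⟩
    f a + 0#                ≈⟨ +-identityʳ (f a) ⟩
    f a                     ∎

  ∑-pair : ∀ m {f : Vec m} {a b} → a ≢ b → Supported f (｛ a ｝ ∪ ｛ b ｝) → ∑ m f ≈ f a + f b
  ∑-pair m {f} {a} {b} a≢b f∈ = begin
    ∑ m f                   ≈⟨ ∑-extract m f a ⟩
    f a + ∑ m (f [ a ]≔ 0#) ≈⟨ +-congˡ (∑-single m ([]≔0-supported f∈)) ⟩
    f a + (f [ a ]≔ 0#) b   ≡⟨ cong (f a +_) (updateAt-minimal b a f (a≢b ∘ ≡.sym)) ⟩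
    f a + f b               ∎

  ∑-triple : ∀ m {f : Vec m} {a b d} → a ≢ b → a ≢ d → b ≢ d →
             Supported f (｛ a ｝ ∪ ｛ b ｝ ∪ ｛ d ｝) → ∑ m f ≈ f a + (f b + f d)
  ∑-triple m {f} {a} {b} {d} a≢b a≢d b≢d f∈ = begin
    ∑ m f                              ≈⟨ ∑-extract m f a ⟩
    f a + ∑ m (f [ a ]≔ 0#)            ≈⟨ +-congˡ (∑-pair m b≢d ([]≔0-supported f∈)) ⟩
    f a + ((f [ a ]≔ 0#) b + (f [ a ]≔ 0#) d)
      ≡⟨ cong (f a +_) (≡.cong₂ _+_ (updateAt-minimal b a f (a≢b ∘ ≡.sym))
                                    (updateAt-minimal d a f (a≢d ∘ ≡.sym))) ⟩
    f a + (f b + f d)                  ∎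

  unit-entry⇒nonzero : ∀ {m} {x : Vec m} a → x a ≡ 1# → ¬ IsZeroVec x
  unit-entry⇒nonzero a xa≡1 x≈0 = 0≉1 (≈-trans (≈-sym (x≈0 a)) (reflexive xa≡1))

  isolate : ∀ {w t y z} → t · y ≈ 1# → w · t + z ≈ 0# → w ≈ z · (- y)
  isolate {w} {t} {y} {z} ty≈1 wt+z≈0 = begin
    w           ≈⟨ *-identityʳ w ⟨
    w · 1#      ≈⟨ *-congˡ ty≈1 ⟨
    w · (t · y) ≈⟨ *-assoc w t y ⟨
    (w · t) · y ≈⟨ *-congʳ (inverseˡ-unique _ _ wt+z≈0) ⟩
    (- z) · y   ≈⟨ -‿distribˡ-* z y ⟨
    - (z · y)   ≈⟨ -‿distribʳ-* z y ⟩
    z · (- y)   ∎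

  difference≈0 : ∀ {u v z} → u ≈ v → z ≈ - v → u · 1# + z ≈ 0#
  difference≈0 u≈v z≈-v = ≈-trans (+-cong (≈-trans (*-identityʳ _) u≈v) z≈-v) (-‿inverseʳ _)

  dependency⇒InSpan1 : ∀ (v w : Vec 3) s t → (∀ r → v r · s + w r · t ≈ 0#) → ¬ s ≈ 0# → InSpan1 v w
  dependency⇒InSpan1 v w s t dep s≉0 with inverse s s≉0
  ... | y , sy≈1 = t · - y , λ r → ≈-trans (isolate sy≈1 (dep r)) (xy·z≈yz·x (w r) t (- y))

  dependency⇒InSpan2 : ∀ (u v w : Vec 3) s t p → (∀ r → v r · t + (u r · s + w r · p) ≈ 0#) →
                       ¬ s ≈ 0# → InSpan2 u v w
  dependency⇒InSpan2 u v w s t p dep s≉0 with inverse s s≉0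
  ... | y , sy≈1 = t · - y , p · - y , λ r →
    ≈-trans (isolate sy≈1 (≈-trans (x∙yz≈y∙xz _ _ _) (dep r)))
            (≈-trans (distribʳ (- y) _ _) (+-cong (xy·z≈yz·x (v r) t (- y)) (xy·z≈yz·x (w r) p (- y))))

  module Codewords {m} (H : Mat3 m) where

    Avoids : Pred (Fin m) 0ℓ → Set (c ⊔ ℓ)
    Avoids S = ∀ x → InCode H x → ¬ IsZeroVec x → ¬ Supported x S

    Avoids-anti : ∀ {S T} → S ⊆ T → Avoids T → Avoids S
    Avoids-anti S⊆T avoids-T x x∈D x≢0 x∈S = avoids-T x x∈D x≢0 (Supported-mono x∈S S⊆T)

    mulVec-pair : ∀ {x a b} → a ≢ b → Supported x (｛ a ｝ ∪ ｛ b ｝) →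
                  ∀ r → mulVec H x r ≈ H r a · x a + H r b · x b
    mulVec-pair a≢b x∈ r = ∑-pair m a≢b (Supported-*ˡ (H r) x∈)

    mulVec-triple : ∀ {x a q b} → a ≢ q → a ≢ b → q ≢ b → Supported x (｛ a ｝ ∪ ｛ q ｝ ∪ ｛ b ｝) →
                    ∀ r → mulVec H x r ≈ H r a · x a + (H r q · x q + H r b · x b)
    mulVec-triple a≢q a≢b q≢b x∈ r = ∑-triple m a≢q a≢b q≢b (Supported-*ˡ (H r) x∈)

    InSpan1⇒¬Avoids : ∀ {a b} → a ≢ b → InSpan1 (column H a) (column H b) → ¬ Avoids (｛ a ｝ ∪ ｛ b ｝)
    InSpan1⇒¬Avoids {a} {b} a≢b (l , a≈lb) avoids = avoids x x∈D (unit-entry⇒nonzero a xa≡1) x∈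
      where
      x : Vec m
      x = ((λ _ → 0#) [ b ]≔ - l) [ a ]≔ 1#
      x∈ : Supported x (｛ a ｝ ∪ ｛ b ｝)
      x∈ = []≔-supported (inj₁ refl) ([]≔-supported (inj₂ refl) λ _ _ → ≈-refl)
      xa≡1 : x a ≡ 1#
      xa≡1 = updateAt-updates a _
      xb≡-l : x b ≡ - l
      xb≡-l = ≡.trans (updateAt-minimal b a _ (a≢b ∘ ≡.sym)) (updateAt-updates b _)
      x∈D : InCode H x
      x∈D r = begin
        mulVec H x r                 ≈⟨ mulVec-pair a≢b x∈ r ⟩
        H r a · x a + H r b · x b    ≡⟨ ≡.cong₂ (λ s t → H r a · s + H r b · t) xa≡1 xb≡-l ⟩
        H r a · 1# + H r b · - l     ≈⟨ difference≈0 (a≈lb r) (≈-trans (≈-sym (-‿distribʳ-* _ l)) (-‿cong (*-comm _ l))) ⟩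
        0#                           ∎

    InSpan2⇒¬Avoids : ∀ {a q b} → a ≢ q → a ≢ b → q ≢ b → InSpan2 (column H q) (column H a) (column H b) →
                      ¬ Avoids (｛ a ｝ ∪ ｛ q ｝ ∪ ｛ b ｝)
    InSpan2⇒¬Avoids {a} {q} {b} a≢q a≢b q≢b (α , β , q≈αa+βb) avoids =
      avoids x x∈D (unit-entry⇒nonzero q xq≡1) x∈
      where
      x : Vec m
      x = (((λ _ → 0#) [ b ]≔ - β) [ a ]≔ - α) [ q ]≔ 1#
      x∈ : Supported x (｛ a ｝ ∪ ｛ q ｝ ∪ ｛ b ｝)
      x∈ = []≔-supported (inj₂ (inj₁ refl)) ([]≔-supported (inj₁ refl)
             ([]≔-supported (inj₂ (inj₂ refl)) λ _ _ → ≈-refl))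
      xq≡1 : x q ≡ 1#
      xq≡1 = updateAt-updates q _
      xa≡-α : x a ≡ - α
      xa≡-α = ≡.trans (updateAt-minimal a q _ a≢q) (updateAt-updates a _)
      xb≡-β : x b ≡ - β
      xb≡-β = ≡.trans (updateAt-minimal b q _ (q≢b ∘ ≡.sym))
                (≡.trans (updateAt-minimal b a _ (a≢b ∘ ≡.sym)) (updateAt-updates b _))
      x∈D : InCode H x
      x∈D r = begin
        mulVec H x r                                   ≈⟨ mulVec-triple a≢q a≢b q≢b x∈ r ⟩
        H r a · x a + (H r q · x q + H r b · x b)      ≡⟨ cong (λ s → H r a · x a + (H r q · s + H r b · x b)) xq≡1 ⟩
        H r a · x a + (H r q · 1# + H r b · x b)       ≡⟨ ≡.cong₂ (λ s t → H r a · s + (H r q · 1# + H r b · t)) xa≡-α xb≡-β ⟩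
        H r a · - α + (H r q · 1# + H r b · - β)       ≈⟨ x∙yz≈y∙xz _ _ _ ⟩
        H r q · 1# + (H r a · - α + H r b · - β)       ≈⟨ difference≈0 (q≈αa+βb r) (rearrange (H r a) α (H r b) β) ⟩
        0#                                             ∎
        where
        rearrange : ∀ h α h′ β → h · - α + h′ · - β ≈ - (α · h + β · h′)
        rearrange h α h′ β = begin
          h · - α + h′ · - β       ≈⟨ +-cong (-‿distribʳ-* h α) (-‿distribʳ-* h′ β) ⟨
          - (h · α) + - (h′ · β)   ≈⟨ ⁻¹-∙-comm _ _ ⟩
          - (h · α + h′ · β)       ≈⟨ -‿cong (+-cong (*-comm h α) (*-comm h′ β)) ⟩
          - (α · h + β · h′)       ∎

    ¬SamePoint⇒Avoids : ∀ {a b} → a ≢ b → Avoids ｛ a ｝ → Avoids ｛ b ｝ →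
                        ¬ SamePoint (column H a) (column H b) → Avoids (｛ a ｝ ∪ ｛ b ｝)
    -- Equality in F need not be decidable, but the goal is ⊥, so ¬¬-excluded-middle still
    -- lets us split on whether a coefficient vanishes.
    ¬SamePoint⇒Avoids {a} {b} a≢b avoids-a avoids-b ¬same x x∈D x≢0 x∈ = ¬¬-excluded-middle λ where
        (yes xa≈0) → avoids-b x x∈D x≢0 (Supported-shrink xa≈0 x∈)
        (no xa≉0) → ¬¬-excluded-middle λ where
          (yes xb≈0) → avoids-a x x∈D x≢0 (Supported-shrink xb≈0 (Supported-mono x∈ swap))
          (no xb≉0) → ¬same ( dependency⇒InSpan1 _ _ _ _ dep xa≉0
                            , dependency⇒InSpan1 _ _ _ _ (λ r → ≈-trans (+-comm _ _) (dep r)) xb≉0)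
      where
      dep : ∀ r → H r a · x a + H r b · x b ≈ 0#
      dep r = ≈-trans (≈-sym (mulVec-pair a≢b x∈ r)) (x∈D r)

    ¬InSpan2⇒Avoids : ∀ {a q b} → a ≢ q → a ≢ b → q ≢ b → Avoids (｛ a ｝ ∪ ｛ b ｝) →
                      ¬ InSpan2 (column H q) (column H a) (column H b) → Avoids (｛ a ｝ ∪ ｛ q ｝ ∪ ｛ b ｝)
    ¬InSpan2⇒Avoids {a} {q} {b} a≢q a≢b q≢b avoids-ab q∉ab x x∈D x≢0 x∈ = ¬¬-excluded-middle λ where
        (yes xq≈0) → avoids-ab x x∈D x≢0 (Supported-shrink xq≈0 (Supported-mono x∈ move-q))
        (no xq≉0) → q∉ab (dependency⇒InSpan2 _ _ _ _ _ _ dep xq≉0)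
      where
      move-q : ｛ a ｝ ∪ ｛ q ｝ ∪ ｛ b ｝ ⊆ ｛ q ｝ ∪ ｛ a ｝ ∪ ｛ b ｝
      move-q = [ inj₂ ∘ inj₁ , ⊎-map id inj₂ ]′
      dep : ∀ r → H r a · x a + (H r q · x q + H r b · x b) ≈ 0#
      dep r = ≈-trans (≈-sym (mulVec-triple a≢q a≢b q≢b x∈ r)) (x∈D r)

module Positions {c ℓ : Level} (F : Field c ℓ) {n : ℕ} (H : FieldDefs.Mat3 F (2 * n ∸ 1))
                 (min-dist : FieldDefs.MinDistAtLeast2 F H) where
  open FieldDefs F
  open FieldDefs2 F
  open LinearAlgebra F
  open Codewords H

  -- Up to argument order, NAvoiding n H is ∀ I → Avoids (positions I), and
  -- MinDistAtLeast2 H is Avoids (λ k → suc (toℕ k) ≡ j) for every j.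
  positions : NSet n → Pred (Fin (2 * n ∸ 1)) 0ℓ
  positions I k = suc (toℕ k) ∈N I

  Avoids-singleton : ∀ a → Avoids ｛ a ｝
  Avoids-singleton a = Avoids-anti (proj₂ (position-≐ refl)) λ x x∈D x≢0 → min-dist x x∈D x≢0 (suc (toℕ a))

  odd-position : ∀ {i} → 1 ≤ i → i ≤ n → Σ (Fin (2 * n ∸ 1)) (λ a → suc (toℕ a) ≡ 2 * i ∸ 1)
  odd-position 1≤i i≤n = position (1≤2*i∸1 1≤i) (2*i∸1-mono-≤ i≤n)

  Avoids-odd-pair : Cond1 n H → ∀ {i j} → 1 ≤ i → i < j → j ≤ n → ∀ {a b} →
                    suc (toℕ a) ≡ 2 * i ∸ 1 → suc (toℕ b) ≡ 2 * j ∸ 1 → Avoids (｛ a ｝ ∪ ｛ b ｝)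
  Avoids-odd-pair cond1 {i} {j} 1≤i i<j j≤n {a} {b} a≡ b≡ =
    ¬SamePoint⇒Avoids (positions-≢ a≡ b≡ (2*i∸1-mono-< 1≤i i<j)) (Avoids-singleton a) (Avoids-singleton b)
      (cond1 i j 1≤i (ℕₚ.≤-trans (ℕₚ.<⇒≤ i<j) j≤n) (ℕₚ.≤-trans 1≤i (ℕₚ.<⇒≤ i<j)) j≤n (ℕₚ.<⇒≢ i<j) a b a≡ b≡)

  Z-distinct : ∀ {a q b : Fin (2 * n ∸ 1)} i → 1 ≤ i → suc (toℕ a) ≡ 2 * i ∸ 1 → suc (toℕ q) ≡ 2 * i →
               suc (toℕ b) ≡ 2 * i ℕ.+ 1 → a ≢ q × a ≢ b × q ≢ b
  Z-distinct i 1≤i a≡ q≡ b≡ =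
    positions-≢ a≡ q≡ a<q , positions-≢ a≡ b≡ (ℕₚ.<-trans a<q q<b) , positions-≢ q≡ b≡ q<b
    where
    a<q = 2*i∸1<2*i 1≤i
    q<b = ℕₚ.m<m+n (2 * i) (s≤s z≤n)

  Z-positions-≐ : ∀ {a q b : Fin (2 * n ∸ 1)} i 1≤i i≤n∸1 → suc (toℕ a) ≡ 2 * i ∸ 1 → suc (toℕ q) ≡ 2 * i →
                  suc (toℕ b) ≡ 2 * i ℕ.+ 1 → positions (Z i 1≤i i≤n∸1) ≐ ｛ a ｝ ∪ ｛ q ｝ ∪ ｛ b ｝
  Z-positions-≐ _ _ _ a≡ q≡ b≡ = ∪-cong-≐ (position-≐ a≡) (∪-cong-≐ (position-≐ q≡) (position-≐ b≡))

  Cond1×Cond2⇒Avoids : Cond1 n H → Cond2 n H → ∀ I → Avoids (positions I)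
  Cond1×Cond2⇒Avoids cond1 _ (X i j 1≤i i<j j≤n) =
    Avoids-anti (proj₁ (∪-cong-≐ (position-≐ a≡) (position-≐ b≡))) (Avoids-odd-pair cond1 1≤i i<j j≤n a≡ b≡)
    where
    a≡ = proj₂ (odd-position 1≤i (ℕₚ.≤-trans (ℕₚ.<⇒≤ i<j) j≤n))
    b≡ = proj₂ (odd-position (ℕₚ.≤-trans 1≤i (ℕₚ.<⇒≤ i<j)) j≤n)
  Cond1×Cond2⇒Avoids _ _ (Y i _ _) x x∈D x≢0 = min-dist x x∈D x≢0 (2 * i)
  Cond1×Cond2⇒Avoids cond1 cond2 (Z i 1≤i i≤n∸1) =
    let a≢q , a≢b , q≢b = Z-distinct i 1≤i a≡ q≡ b≡ in
    Avoids-anti (proj₁ (Z-positions-≐ i 1≤i i≤n∸1 a≡ q≡ b≡))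
      (¬InSpan2⇒Avoids a≢q a≢b q≢b (Avoids-odd-pair cond1 1≤i (ℕₚ.n<1+n i) i<n a≡ b≡odd)
        (cond2 i 1≤i i≤n∸1 _ _ _ a≡ q≡ b≡))
    where
    i<n = ≤∸1⇒< 1≤i i≤n∸1
    a≡ = proj₂ (odd-position 1≤i (ℕₚ.<⇒≤ i<n))
    q≡ = proj₂ (position (ℕₚ.≤-trans 1≤i (ℕₚ.m≤n*m i 2)) (ℕₚ.<⇒≤ (2*i<2*n∸1 i<n)))
    b≡odd = proj₂ (odd-position (s≤s z≤n) i<n)
    b≡ = ≡.trans b≡odd (≡.trans (2*suc∸1 i) (ℕₚ.+-comm 1 (2 * i)))

  Avoids⇒Cond1 : (∀ I → Avoids (positions I)) → Cond1 n H
  Avoids⇒Cond1 avoids i j 1≤i i≤n 1≤j j≤n i≢j a b a≡ b≡ (a∈b , b∈a) with ℕₚ.<-cmp i j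
  ... | tri< i<j _ _ = InSpan1⇒¬Avoids (positions-≢ a≡ b≡ (2*i∸1-mono-< 1≤i i<j)) a∈b
        (Avoids-anti (proj₂ (∪-cong-≐ (position-≐ a≡) (position-≐ b≡))) (avoids (X i j 1≤i i<j j≤n)))
  ... | tri≈ _ i≡j _ = i≢j i≡j
  ... | tri> _ _ j<i = InSpan1⇒¬Avoids (positions-≢ b≡ a≡ (2*i∸1-mono-< 1≤j j<i)) b∈a
        (Avoids-anti (proj₂ (∪-cong-≐ (position-≐ b≡) (position-≐ a≡))) (avoids (X j i 1≤j j<i i≤n)))

  Avoids⇒Cond2 : (∀ I → Avoids (positions I)) → Cond2 n H
  Avoids⇒Cond2 avoids i 1≤i i≤n∸1 a q b a≡ q≡ b≡ q∈ab =
    let a≢q , a≢b , q≢b = Z-distinct i 1≤i a≡ q≡ b≡ in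
    InSpan2⇒¬Avoids a≢q a≢b q≢b q∈ab
      (Avoids-anti (proj₂ (Z-positions-≐ i 1≤i i≤n∸1 a≡ q≡ b≡)) (avoids (Z i 1≤i i≤n∸1)))

proposition4p20 : {c ℓ : Level} (F : Field c ℓ) (n : ℕ) → 2 ≤ n →
    (H : FieldDefs.Mat3 F (2 * n ∸ 1)) →
    FieldDefs.RowsIndependent F H →
    FieldDefs.MinDistAtLeast2 F H →
    (FieldDefs2.NAvoiding F n H ⇔ (FieldDefs2.Cond1 F n H × FieldDefs2.Cond2 F n H))
proposition4p20 F n _ H _ min-dist = mk⇔
  (λ avoiding → let avoids I x x∈D x≢0 = avoiding x x∈D x≢0 I in Avoids⇒Cond1 avoids , Avoids⇒Cond2 avoids)
  (λ (cond1 , cond2) x x∈D x≢0 I → Cond1×Cond2⇒Avoids cond1 cond2 I x x∈D x≢0)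
  where open Positions F {n} H min-dist
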